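{- In Ruleset D, a superposition of single Nim heaps has value $*k$ where $k$ is the size of its largest heap, i.e. $\langle \mathrm{Nim}(i_1),\dots,\mathrm{Nim}(i_\ell)\rangle_D\equiv *k$ with $k=\max_{1\le j\le\ell} i_j$.
   Context: $\mathrm{Nim}(x)$ is a single Nim heap of $x$ tokens; a classical move $(1,-j)$, $j\ge1$, removes $j$ tokens and is legal iff $x\ge j$. Quantum variation: a quantum position is a finite nonempty set $\langle G_1,\dots,G_n\rangle$ of classical positions (multiplicities irrelevant). A classical move is legal in it if legal in at least one $G_i$. A Q-move is a finite nonempty set of classical moves, each legal in the current quantum position; it leads to the set of all positions obtained by applying one of its moves to one of the $G_i$ where that move is legal. Ruleset D (subscript $D$): every such Q-move is allowed, including ones consisting of a single classical move. Normal convention: a player with no allowed Q-move loses. $*n$ denotes the value (equivalence class under $G\equiv H$ iff $G+X$, $H+X$ have the same outcome for all games $X$) of a classical Nim heap of $n$ tokens, with $*0=0$. -}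

module Defs where

open import Data.Nat using (ℕ; zero; suc; _∸_; _⊔_; _≤ᵇ_)
open import Data.Bool using (Bool; true; false; not; _∨_; if_then_else_)
open import Data.List using (List; []; _∷_; _++_; map; concatMap; foldr; upTo)
open import Relation.Binary.PropositionalEquality using (_≡_)

-- Short impartial games (finite game trees), normal play.

data Game : Set where
  mk : List Game → Game

mutual
  infixl 6 _⊕_
  _⊕_ : Game → Game → Game
  mk gs ⊕ mk hs = mk (leftOpts gs (mk hs) ++ rightOpts (mk gs) hs)

  leftOpts : List Game → Game → List Game
  leftOpts []       h = []
  leftOpts (g ∷ gs) h = (g ⊕ h) ∷ leftOpts gs h

  rightOpts : Game → List Game → List Game
  rightOpts g []       = []
  rightOpts g (h ∷ hs) = (g ⊕ h) ∷ rightOpts g hs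

mutual
  firstWins : Game → Bool
  firstWins (mk gs) = someLosing gs

  someLosing : List Game → Bool
  someLosing []       = false
  someLosing (g ∷ gs) = not (firstWins g) ∨ someLosing gs

infix 4 _≈g_
_≈g_ : Game → Game → Set
G ≈g H = ∀ (X : Game) → firstWins (G ⊕ X) ≡ firstWins (H ⊕ X)

mutual
  nim : ℕ → Game
  nim n = mk (nimOpts n)

  nimOpts : ℕ → List Game
  nimOpts zero    = []
  nimOpts (suc n) = nim n ∷ nimOpts n

-- Quantum Nim under Ruleset D.
-- A quantum position <Nim(x_1),...,Nim(x_l)> is represented by the list
-- of heap sizes (duplicates irrelevant).

maxList : List ℕ → ℕ
maxList = foldr _⊔_ 0

subsets : {A : Set} → List A → List (List A)
subsets []       = [] ∷ []
subsets (x ∷ xs) = let ss = subsets xs in ss ++ map (x ∷_) ss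

nonemptyOnly : {A : Set} → List (List A) → List (List A)
nonemptyOnly []             = []
nonemptyOnly ([] ∷ ss)      = nonemptyOnly ss
nonemptyOnly ((x ∷ s) ∷ ss) = (x ∷ s) ∷ nonemptyOnly ss

-- Classical moves (1,-j) legal in the quantum position xs:
-- j ≥ 1 and j ≤ x for some heap x, i.e. j ∈ {1, …, max xs}.
legalMoves : List ℕ → List ℕ
legalMoves xs = map suc (upTo (maxList xs))

-- Ruleset D: every finite nonempty set of legal classical moves is a Q-move.
qMoves : List ℕ → List (List ℕ)
qMoves xs = nonemptyOnly (subsets (legalMoves xs))

applyQ : List ℕ → List ℕ → List ℕ
applyQ S xs = concatMap (λ j → concatMap (λ x → if j ≤ᵇ x then x ∸ j ∷ [] else []) xs) S

-- Game tree of a quantum position, built with fuel; every Q-move strictly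
-- decreases the maximal heap, so fuel suc (maxList xs) suffices.
qGameF : ℕ → List ℕ → Game
qGameF zero    xs = mk []
qGameF (suc f) xs = mk (map (λ S → qGameF f (applyQ S xs)) (qMoves xs))

qGame : List ℕ → Game
qGame xs = qGameF (suc (maxList xs)) xs

module Submission where

-- The proof rests on one general fact about impartial games: if every option
-- of G is equivalent to some *a with a < k, and every *a with a < k is
-- equivalent to some option of G, then G ≈g *k (the mex rule in the form
-- needed here).  This in turn follows from the observation that two games
-- whose option lists match up to equivalence are themselves equivalent.
--
-- For the quantum position both hypotheses are checked by induction on the
-- height of the game tree: a Q-move S lowers the largest heap from k to
-- k ∸ min S < k, so each option has value *a for some a < k; and the
-- single-move Q-move {k ∸ a} reaches a position whose largest heap is
-- exactly a, for every a < k.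

open import Defs
open import Data.Nat using (ℕ; suc; _∸_; _⊔_; _≤ᵇ_; _<_; _≤_; z≤n; s≤s)
open import Data.Nat.Properties
  using (≤-refl; ≤-trans; <-≤-trans; <⇒≤; m≤n⇒m<n∨m≡n; m≤n⇒m≤1+n; m∸n≤m;
         m<n⇒0<n∸m; m∸[m∸n]≡n; ∸-distribʳ-⊔; ⊔-assoc; ⊔-identityʳ;
         ⊔-pres-<m; 0∸n≡0; m≤n⇒m∸n≡0; ≰⇒>; ≤⇒≤ᵇ)
open import Data.Bool using (true; false; not; _∨_; if_then_else_; T)
open import Data.Bool.Properties using (⇔→≡; ∨-assoc)
open import Data.List using (List; []; _∷_; _++_; map; concatMap; [_])
open import Data.List.Relation.Unary.Any using (Any; here; there)
open import Data.List.Membership.Propositional using (_∈_; find; lose)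
open import Data.List.Membership.Propositional.Properties
  using (∈-map⁺; ∈-map⁻; ∈-++⁺ˡ; ∈-++⁺ʳ; ∈-++⁻; ∈-upTo⁺; ∈-upTo⁻)
open import Data.List.Relation.Binary.Subset.Propositional using (_⊆_)
open import Data.Product using (∃-syntax; _×_; _,_; proj₁; proj₂)
open import Data.Sum using (inj₁; inj₂)
open import Function.Bundles using (mk⇔)
open import Relation.Binary.PropositionalEquality
  using (_≡_; _≢_; refl; sym; trans; cong; cong₂; subst; module ≡-Reasoning)

Losing : Game → Set
Losing g = firstWins g ≡ false

≈g-sym : {G H : Game} → G ≈g H → H ≈g G
≈g-sym G≈H X = sym (G≈H X)

someLosing-++ : (as bs : List Game) → someLosing (as ++ bs) ≡ someLosing as ∨ someLosing bs
someLosing-++ []       bs = refl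
someLosing-++ (g ∷ as) bs =
  trans (cong (not (firstWins g) ∨_) (someLosing-++ as bs)) (sym (∨-assoc (not (firstWins g)) _ _))

LeftWin : List Game → Game → Set
LeftWin gs X = Any (λ g → Losing (g ⊕ X)) gs

leftWin⁻ : (gs : List Game) (X : Game) → someLosing (leftOpts gs X) ≡ true → LeftWin gs X
leftWin⁻ []       X ()
leftWin⁻ (g ∷ gs) X wins with firstWins (g ⊕ X) in losing
... | false = here losing
... | true  = there (leftWin⁻ gs X wins)

leftWin⁺ : (gs : List Game) (X : Game) → LeftWin gs X → someLosing (leftOpts gs X) ≡ true
leftWin⁺ (g ∷ gs) X (here losing) rewrite losing = refl
leftWin⁺ (g ∷ gs) X (there win) rewrite leftWin⁺ gs X win with firstWins (g ⊕ X)
... | true  = refl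
... | false = refl

Covers : List Game → List Game → Set
Covers gs hs = ∀ {g} → g ∈ gs → ∃[ h ] h ∈ hs × g ≈g h

leftWin-transfer : {gs hs : List Game} → Covers gs hs → (X : Game) → LeftWin gs X → LeftWin hs X
leftWin-transfer gs⊑hs X win with find win
... | g , g∈gs , losing with gs⊑hs g∈gs
... | h , h∈hs , g≈h = lose h∈hs (trans (sym (g≈h X)) losing)

module _ {gs hs : List Game} (gs⊑hs : Covers gs hs) (hs⊑gs : Covers hs gs) where

  leftMoves : (X : Game) → someLosing (leftOpts gs X) ≡ someLosing (leftOpts hs X)
  leftMoves X = ⇔→≡ (mk⇔
    (λ wins → leftWin⁺ hs X (leftWin-transfer gs⊑hs X (leftWin⁻ gs X wins)))
    (λ wins → leftWin⁺ gs X (leftWin-transfer hs⊑gs X (leftWin⁻ hs X wins))))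

  mutual
    options-congruence : mk gs ≈g mk hs
    options-congruence (mk ys) = begin
      someLosing (leftOpts gs (mk ys) ++ rightOpts (mk gs) ys)
        ≡⟨ someLosing-++ (leftOpts gs (mk ys)) _ ⟩
      someLosing (leftOpts gs (mk ys)) ∨ someLosing (rightOpts (mk gs) ys)
        ≡⟨ cong₂ _∨_ (leftMoves (mk ys)) (rightMoves ys) ⟩
      someLosing (leftOpts hs (mk ys)) ∨ someLosing (rightOpts (mk hs) ys)
        ≡⟨ sym (someLosing-++ (leftOpts hs (mk ys)) _) ⟩
      someLosing (leftOpts hs (mk ys) ++ rightOpts (mk hs) ys) ∎
      where open ≡-Reasoning

    rightMoves : (ys : List Game) → someLosing (rightOpts (mk gs) ys) ≡ someLosing (rightOpts (mk hs) ys)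
    rightMoves []       = refl
    rightMoves (y ∷ ys) = cong₂ (λ b c → not b ∨ c) (options-congruence y) (rightMoves ys)

∈-nimOpts⁺ : {k a : ℕ} → a < k → nim a ∈ nimOpts k
∈-nimOpts⁺ {suc k} (s≤s a≤k) with m≤n⇒m<n∨m≡n a≤k
... | inj₁ a<k  = there (∈-nimOpts⁺ a<k)
... | inj₂ refl = here refl

∈-nimOpts⁻ : {h : Game} (k : ℕ) → h ∈ nimOpts k → ∃[ a ] a < k × h ≡ nim a
∈-nimOpts⁻ (suc k) (here refl) = k , ≤-refl , refl
∈-nimOpts⁻ (suc k) (there h∈) with ∈-nimOpts⁻ k h∈
... | a , a<k , refl = a , m≤n⇒m≤1+n a<k , refl

mex-lemma : (gs : List Game) (k : ℕ)
  → (∀ {g} → g ∈ gs → ∃[ a ] a < k × g ≈g nim a)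
  → (∀ {a} → a < k → ∃[ g ] g ∈ gs × g ≈g nim a)
  → mk gs ≈g nim k
mex-lemma gs k below reached = options-congruence gs⊑nim nim⊑gs
  where
  gs⊑nim : Covers gs (nimOpts k)
  gs⊑nim g∈gs with below g∈gs
  ... | a , a<k , g≈a = nim a , ∈-nimOpts⁺ a<k , g≈a

  nim⊑gs : Covers (nimOpts k) gs
  nim⊑gs h∈ with ∈-nimOpts⁻ k h∈
  ... | a , a<k , refl with reached a<k
  ... | g , g∈gs , g≈a = g , g∈gs , ≈g-sym {g} {nim a} g≈a

maxList-++ : (as bs : List ℕ) → maxList (as ++ bs) ≡ maxList as ⊔ maxList bs
maxList-++ []       bs = refl
maxList-++ (x ∷ as) bs rewrite maxList-++ as bs = sym (⊔-assoc x (maxList as) (maxList bs))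

removeFrom : ℕ → ℕ → List ℕ
removeFrom j x = if j ≤ᵇ x then x ∸ j ∷ [] else []

maxList-removeFrom : (j x : ℕ) → maxList (removeFrom j x) ≡ x ∸ j
maxList-removeFrom j x with j ≤ᵇ x in legal
... | true  = ⊔-identityʳ (x ∸ j)
... | false = sym (m≤n⇒m∸n≡0 (<⇒≤ (≰⇒> (λ (j≤x : j ≤ x) → subst T legal (≤⇒≤ᵇ j≤x)))))

maxList-move : (j : ℕ) (xs : List ℕ) → maxList (concatMap (removeFrom j) xs) ≡ maxList xs ∸ j
maxList-move j []       = sym (0∸n≡0 j)
maxList-move j (x ∷ xs) = begin
  maxList (removeFrom j x ++ concatMap (removeFrom j) xs)
    ≡⟨ maxList-++ (removeFrom j x) _ ⟩
  maxList (removeFrom j x) ⊔ maxList (concatMap (removeFrom j) xs)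
    ≡⟨ cong₂ _⊔_ (maxList-removeFrom j x) (maxList-move j xs) ⟩
  (x ∸ j) ⊔ (maxList xs ∸ j)
    ≡⟨ sym (∸-distribʳ-⊔ j x (maxList xs)) ⟩
  (x ⊔ maxList xs) ∸ j ∎
  where open ≡-Reasoning

∸-positive-< : {j k : ℕ} → 1 ≤ j → 0 < k → k ∸ j < k
∸-positive-< {suc j} {suc k} _ _ = s≤s (m∸n≤m k j)

maxList-applyQ-< : (S xs : List ℕ) → 0 < maxList xs → (∀ {j} → j ∈ S → 1 ≤ j)
  → maxList (applyQ S xs) < maxList xs
maxList-applyQ-< []      xs k>0 positive = k>0
maxList-applyQ-< (j ∷ S) xs k>0 positive
  rewrite maxList-++ (concatMap (removeFrom j) xs) (applyQ S xs) | maxList-move j xs =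
  ⊔-pres-<m (∸-positive-< (positive (here refl)) k>0)
            (maxList-applyQ-< S xs k>0 (λ j∈S → positive (there j∈S)))

maxList-applyQ-single : (j : ℕ) (xs : List ℕ) → maxList (applyQ [ j ] xs) ≡ maxList xs ∸ j
maxList-applyQ-single j xs = begin
  maxList (concatMap (removeFrom j) xs ++ [])       ≡⟨ maxList-++ (concatMap (removeFrom j) xs) [] ⟩
  maxList (concatMap (removeFrom j) xs) ⊔ 0         ≡⟨ ⊔-identityʳ _ ⟩
  maxList (concatMap (removeFrom j) xs)             ≡⟨ maxList-move j xs ⟩
  maxList xs ∸ j ∎
  where open ≡-Reasoning

[]∈subsets : {A : Set} (l : List A) → [] ∈ subsets l
[]∈subsets []      = here refl
[]∈subsets (x ∷ l) = ∈-++⁺ˡ ([]∈subsets l)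

[-]∈subsets : {A : Set} {l : List A} {y : A} → y ∈ l → [ y ] ∈ subsets l
[-]∈subsets {l = x ∷ l} (here refl) = ∈-++⁺ʳ (subsets l) (∈-map⁺ (x ∷_) ([]∈subsets l))
[-]∈subsets {l = x ∷ l} (there y∈l) = ∈-++⁺ˡ ([-]∈subsets y∈l)

∈subsets⇒⊆ : {A : Set} (l : List A) {S : List A} → S ∈ subsets l → S ⊆ l
∈subsets⇒⊆ []      (here refl) ()
∈subsets⇒⊆ (x ∷ l) S∈ j∈S with ∈-++⁻ (subsets l) S∈
... | inj₁ S∈l = there (∈subsets⇒⊆ l S∈l j∈S)
... | inj₂ S∈xl with ∈-map⁻ (x ∷_) S∈xl
...   | T , T∈l , refl with j∈S
...     | here refl = here refl
...     | there j∈T = there (∈subsets⇒⊆ l T∈l j∈T)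

∈-nonemptyOnly⁺ : {A : Set} (ss : List (List A)) {y : A} {s : List A}
  → (y ∷ s) ∈ ss → (y ∷ s) ∈ nonemptyOnly ss
∈-nonemptyOnly⁺ ([] ∷ ss)      (there ys∈) = ∈-nonemptyOnly⁺ ss ys∈
∈-nonemptyOnly⁺ ((x ∷ s) ∷ ss) (here eq)   = here eq
∈-nonemptyOnly⁺ ((x ∷ s) ∷ ss) (there ys∈) = there (∈-nonemptyOnly⁺ ss ys∈)

∈-nonemptyOnly⁻ : {A : Set} (ss : List (List A)) {S : List A}
  → S ∈ nonemptyOnly ss → S ∈ ss × ∃[ y ] y ∈ S
∈-nonemptyOnly⁻ ([] ∷ ss) S∈ with ∈-nonemptyOnly⁻ ss S∈
... | S∈ss , nonempty = there S∈ss , nonempty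
∈-nonemptyOnly⁻ ((x ∷ s) ∷ ss) (here refl) = here refl , x , here refl
∈-nonemptyOnly⁻ ((x ∷ s) ∷ ss) (there S∈) with ∈-nonemptyOnly⁻ ss S∈
... | S∈ss , nonempty = there S∈ss , nonempty

legalMoves⁻ : (xs : List ℕ) {j : ℕ} → j ∈ legalMoves xs → 1 ≤ j × j ≤ maxList xs
legalMoves⁻ xs j∈ with ∈-map⁻ suc j∈
... | i , i∈ , refl = s≤s z≤n , ∈-upTo⁻ i∈

qMove-sound : (xs : List ℕ) {S : List ℕ} → S ∈ qMoves xs
  → 0 < maxList xs × (∀ {j} → j ∈ S → 1 ≤ j)
qMove-sound xs S∈ with ∈-nonemptyOnly⁻ (subsets (legalMoves xs)) S∈
... | S∈subsets , y , y∈S =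
  ≤-trans j≥1 j≤k , λ j∈S → proj₁ (legalMoves⁻ xs (S⊆legal j∈S))
  where
  S⊆legal = ∈subsets⇒⊆ (legalMoves xs) S∈subsets
  j≥1 = proj₁ (legalMoves⁻ xs (S⊆legal y∈S))
  j≤k = proj₂ (legalMoves⁻ xs (S⊆legal y∈S))

qMove-single : (xs : List ℕ) {j : ℕ} → 1 ≤ j → j ≤ maxList xs → [ j ] ∈ qMoves xs
qMove-single xs {suc i} _ j≤k =
  ∈-nonemptyOnly⁺ (subsets (legalMoves xs)) ([-]∈subsets (∈-map⁺ suc (∈-upTo⁺ j≤k)))

qGameF-value : (f : ℕ) (xs : List ℕ) → maxList xs < f → qGameF f xs ≈g nim (maxList xs)
qGameF-value (suc f) xs (s≤s k≤f) = mex-lemma options k every-option-below every-value-reached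
  where
  k       = maxList xs
  option  = λ S → qGameF f (applyQ S xs)
  options = map option (qMoves xs)

  option-value : (S : List ℕ) → maxList (applyQ S xs) < k → option S ≈g nim (maxList (applyQ S xs))
  option-value S smaller = qGameF-value f (applyQ S xs) (<-≤-trans smaller k≤f)

  every-option-below : ∀ {g} → g ∈ options → ∃[ a ] a < k × g ≈g nim a
  every-option-below g∈ with ∈-map⁻ option g∈
  ... | S , S∈ , refl with qMove-sound xs S∈
  ... | k>0 , positive = _ , smaller , option-value S smaller
    where smaller = maxList-applyQ-< S xs k>0 positive

  every-value-reached : ∀ {a} → a < k → ∃[ g ] g ∈ options × g ≈g nim a
  every-value-reached {a} a<k =
    option [ j ] , ∈-map⁺ option (qMove-single xs j≥1 (m∸n≤m k a)) ,
    subst (λ b → option [ j ] ≈g nim b) max≡a (option-value [ j ] (subst (_< k) (sym max≡a) a<k))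
    where
    j     = k ∸ a
    j≥1   = m<n⇒0<n∸m a<k
    max≡a : maxList (applyQ [ j ] xs) ≡ a
    max≡a = trans (maxList-applyQ-single j xs) (m∸[m∸n]≡n (<⇒≤ a<k))

mainTheorem6 : (xs : List ℕ) → xs ≢ [] → qGame xs ≈g nim (maxList xs)
mainTheorem6 xs _ = qGameF-value (suc (maxList xs)) xs ≤-refl
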